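{- Let $k\geq 1$ and let $p$ be the partially ordered pattern of length $k$ on the labels $\{1,\dots,k\}$ in which one label $x_1\in\{1,\dots,k\}$ is greater than every other label, and there are no other relations. Let $a(n)$ be the number of $n$-permutations avoiding $p$. Then $$a(n)=\begin{cases} n! & \text{if } n<k,\\ (k-1)!\,(k-1)^{n-k+1} & \text{if } n\geq k,\end{cases}$$ and $$\sum_{n\geq 0}a(n)x^n=\frac{(k-1)(k-1)!\,x^k}{1-(k-1)x}+\sum_{i=0}^{k-1}i!\,x^i.$$
   Context: An $n$-permutation is a permutation $\pi=\pi_1\cdots\pi_n$ of $\{1,\dots,n\}$ written in one-line notation (for $n=0$ there is exactly one, the empty permutation). A partially ordered pattern (POP) $p$ of length $k$ is a partial order $<_P$ on the label set $\{1,\dots,k\}$. An occurrence of $p$ in $\pi$ is a subsequence $\pi_{i_1}\pi_{i_2}\cdots\pi_{i_k}$ with $1\leq i_1<\cdots<i_k\leq n$ such that $\pi_{i_j}<\pi_{i_m}$ whenever $j<_P m$ (no condition is imposed on pairs of incomparable labels). A permutation avoids $p$ if it contains no occurrence of $p$. -}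

module Defs where

open import Data.Nat using (ℕ; zero; suc; _+_; _*_; _∸_; _^_; _!) renaming (_≤?_ to _≤ℕ?_; _<?_ to _<ℕ?_)
open import Data.Fin using (Fin; _<_)
open import Data.Fin.Properties using (_<?_; _≟_; all?; any?)
open import Data.Vec using (Vec; []; _∷_; lookup)
open import Data.List using (allFin; map)
open import Data.Nat.ListAction using (sum)
open import Data.Product using (Σ; ∃; _×_; _,_)
open import Relation.Binary.PropositionalEquality using (_≡_; _≢_)
open import Relation.Nullary using (Dec; yes; no; ¬_)
open import Relation.Nullary.Decidable using (map′; _×-dec_; _→-dec_; ¬?; does)
open import Data.Bool using (if_then_else_)

countVec : ∀ {n} k (P : Vec (Fin n) k → Set) → (∀ v → Dec (P v)) → ℕ
countVec zero    P P? = if does (P? []) then 1 else 0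
countVec {n} (suc k) P P? =
  sum (map (λ a → countVec k (λ w → P (a ∷ w)) (λ w → P? (a ∷ w))) (allFin n))

exVec? : ∀ {n} k {P : Vec (Fin n) k → Set} → (∀ v → Dec (P v)) → Dec (∃ P)
exVec? zero    P? with P? []
... | yes p = yes ([] , p)
... | no ¬p = no λ { ([] , p) → ¬p p }
exVec? (suc k) {P} P? =
  map′ (λ { (a , w , p) → (a ∷ w) , p })
       (λ { ((a ∷ w) , p) → a , w , p })
       (any? (λ a → exVec? k (λ w → P? (a ∷ w))))

-- An n-permutation in one-line notation, with values in Fin n (i.e. the
-- values 0..n-1 stand for 1..n): a vector π with π_i = lookup π i that is
-- injective (hence a bijection of Fin n).
IsPerm : ∀ {n} → Vec (Fin n) n → Set
IsPerm {n} π = ∀ (i j : Fin n) → lookup π i ≡ lookup π j → i ≡ j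

IsPerm? : ∀ {n} (π : Vec (Fin n) n) → Dec (IsPerm π)
IsPerm? π = all? λ i → all? λ j → (lookup π i ≟ lookup π j) →-dec (i ≟ j)

-- A POP of length k: a (decidable) relation _<P_ on the labels Fin k,
-- where  j <P m  means the label j is below the label m.
record POP (k : ℕ) : Set₁ where
  field
    _<P_  : Fin k → Fin k → Set
    _<P?_ : ∀ j m → Dec (j <P m)
open POP public

StrictlyIncreasing : ∀ {n k} → Vec (Fin n) k → Set
StrictlyIncreasing {k = k} ι = ∀ (j m : Fin k) → j < m → lookup ι j < lookup ι m

Occurrence : ∀ {n k} → POP k → Vec (Fin n) n → Vec (Fin n) k → Set
Occurrence {k = k} p π ι =
  StrictlyIncreasing ι ×
  (∀ (j m : Fin k) → _<P_ p j m → lookup π (lookup ι j) < lookup π (lookup ι m))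

Occurrence? : ∀ {n k} (p : POP k) (π : Vec (Fin n) n) (ι : Vec (Fin n) k) →
              Dec (Occurrence p π ι)
Occurrence? p π ι =
  (all? λ j → all? λ m → (j <? m) →-dec (lookup ι j <? lookup ι m))
  ×-dec
  (all? λ j → all? λ m → _<P?_ p j m →-dec
      (lookup π (lookup ι j) <? lookup π (lookup ι m)))

Avoids : ∀ {n k} → POP k → Vec (Fin n) n → Set
Avoids {k = k} p π = ¬ (∃ λ (ι : Vec _ k) → Occurrence p π ι)

Avoids? : ∀ {n k} (p : POP k) (π : Vec (Fin n) n) → Dec (Avoids p π)
Avoids? {k = k} p π = ¬? (exVec? k (Occurrence? p π))

numAvoiders : ∀ {k} → POP k → ℕ → ℕ
numAvoiders p n =
  countVec n (λ π → IsPerm π × Avoids p π) (λ π → IsPerm? π ×-dec Avoids? p π)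

maxPOP : ∀ {k} → Fin k → POP k
maxPOP x = record
  { _<P_  = λ j m → m ≡ x × j ≢ x
  ; _<P?_ = λ j m → (m ≟ x) ×-dec ¬? (j ≟ x)
  }

-- Formal power series over ℕ, represented by their coefficient sequences.

FPS : Set
FPS = ℕ → ℕ

_⊕_ : FPS → FPS → FPS
(f ⊕ g) n = f n + g n

scale : ℕ → FPS → FPS
scale c f n = c * f n

shiftBy : ℕ → FPS → FPS
shiftBy k f n = if does (k ≤ℕ? n) then f (n ∸ k) else 0

-- 1 / (1 - r x) = Σ_n r^n x^n
geom : ℕ → FPS
geom r n = r ^ n

polyBelow : ℕ → (ℕ → ℕ) → FPS
polyBelow k c n = if does (n <ℕ? k) then c n else 0

rhsSeries : ℕ → FPS
rhsSeries k =
  scale ((k ∸ 1) * (k ∸ 1) !) (shiftBy k (geom (k ∸ 1))) ⊕ polyBelow k _!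

-- An occurrence of maxPOP x consists of k = K + 1 increasing positions whose entry at label x,
-- preceded by α = x labels and followed by β = K - α labels, exceeds the other entries. Hence the
-- maximum n of an (n+1)-permutation lies in no occurrence iff fewer than α entries precede it or
-- fewer than β follow it, and every occurrence avoiding the maximum is an occurrence in the
-- n-permutation obtained by deleting it. So the avoiders of length n + 1 are exactly the
-- permutations obtained from an avoider of length n by inserting n at one of the first α or the
-- last β of the n + 1 positions, of which there are min (n + 1, K). The recurrence
-- a (n + 1) = min (n + 1, K) a n with a 0 = 1 gives both formulas.
module Submission where

open import Defs
open import Data.Nat
  using (ℕ; zero; suc; pred; _+_; _*_; _∸_; _^_; _!; _⊓_; _≤_; _<_; _≤?_; _<?_; s≤s; s≤s⁻¹; z≤n; z<s)
open import Data.Nat.Properties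
  using (≤-refl; ≤-trans; ≤-reflexive; <-trans; <⇒≤; <⇒≱; <⇒≢; ≮⇒≥; ≰⇒>; n≮n; <-≤-trans; ≤-<-trans;
         m≤m+n; m≤n+m; m≤n⇒m≤1+n; +-identityʳ; +-suc; +-comm; +-monoˡ-≤; +-monoʳ-≤; +-monoʳ-<;
         ∸-monoˡ-≤; ∸-monoˡ-<; n∸n≡0; m+[n∸m]≡n; *-identityʳ; *-zeroʳ; *-assoc; m≤n⇒m⊓n≡m; m≥n⇒m⊓n≡n;
         *-commutativeSemigroup)
open import Data.Nat.ListAction using (sum)
open import Algebra.Properties.CommutativeSemigroup *-commutativeSemigroup using (x∙yz≈y∙xz)
open import Data.Fin using (Fin; zero; suc; toℕ; fromℕ; fromℕ<; inject₁; lower₁; punchIn; punchOut)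
import Data.Fin as Fin
open import Data.Fin.Properties
  using (_≟_; any?; <-cmp; ≤-antisym; ≤fromℕ; toℕ-injective; toℕ-fromℕ; toℕ-fromℕ<; toℕ-inject₁;
         toℕ≤pred[n]; inject₁ℕ<; fromℕ≢inject₁; inject₁-injective; inject₁-lower₁; punchIn-injective;
         punchInᵢ≢i; punchIn-punchOut; punchIn-mono-≤; punchIn-cancel-≤; injective⇒existsPivot)
open import Data.Vec using (Vec; []; _∷_; lookup; insertAt; map; tabulate)
open import Data.Vec.Properties
  using (∷-injective; insertAt-lookup; insertAt-punchIn; lookup-map; lookup∘tabulate; tabulate∘lookup;
         tabulate-cong)
open import Data.List using (List; []; _∷_; [_]; _++_; length; filter; allFin; cartesianProduct; cartesianProductWith)
import Data.List as List
open import Data.List.Properties using (length-++; length-map; filter-++; map-cong)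
open import Data.List.Membership.Propositional using (_∈_)
open import Data.List.Membership.Propositional.Properties
  using (∈-filter⁺; ∈-filter⁻; ∈-map⁺; ∈-map⁻; ∈-cartesianProductWith⁺; ∈-cartesianProduct⁺;
         ∈-cartesianProduct⁻; ∈-allFin)
open import Data.List.Membership.Propositional.Properties.WithK using (unique∧set⇒bag)
open import Data.List.Relation.Unary.Any using (here)
import Data.List.Relation.Unary.All as All
import Data.List.Relation.Unary.AllPairs as AllPairs
open import Data.List.Relation.Unary.Unique.Propositional using (Unique)
open import Data.List.Relation.Unary.Unique.Propositional.Properties
  using (map⁺; filter⁺; cartesianProductWith⁺; cartesianProduct⁺; allFin⁺)
open import Data.List.Relation.Binary.BagAndSetEquality using (∼bag⇒↭)
open import Data.List.Relation.Binary.Permutation.Propositional.Properties using (↭-length)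
open import Data.Product using (∃; ∃₂; _×_; _,_; proj₁; uncurry)
open import Data.Sum using (_⊎_; inj₁; inj₂)
import Data.Sum as Sum
open import Data.Bool using (if_then_else_)
open import Function using (_∘_; _⇔_; mk⇔; Equivalence)
open import Function.Construct.Composition using (_⇔-∘_)
import Function.Properties.Equivalence as ⇔
open import Relation.Nullary using (yes; no; contradiction)
open import Relation.Nullary.Decidable using (_×-dec_; _⊎-dec_; dec-true; dec-false)
open import Relation.Unary using (Decidable)
open import Relation.Binary using (tri<; tri≈; tri>)
open import Relation.Binary.PropositionalEquality
  using (_≡_; _≢_; refl; sym; trans; cong; cong₂; subst; subst₂; module ≡-Reasoning)

open ≡-Reasoning

private variable
  A B C : Set
  k m n : ℕ

length-filter-map : {P : B → Set} (P? : Decidable P) (f : A → B) (xs : List A) →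
                    length (filter P? (List.map f xs)) ≡ length (filter (P? ∘ f) xs)
length-filter-map P? f [] = refl
length-filter-map P? f (x ∷ xs) with P? (f x)
... | yes _ = cong suc (length-filter-map P? f xs)
... | no _ = length-filter-map P? f xs

length-filter-cartesianProductWith :
  {P : C → Set} (P? : Decidable P) (f : A → B → C) (xs : List A) (ys : List B) →
  length (filter P? (cartesianProductWith f xs ys)) ≡ sum (List.map (λ x → length (filter (P? ∘ f x) ys)) xs)
length-filter-cartesianProductWith P? f [] ys = refl
length-filter-cartesianProductWith P? f (x ∷ xs) ys = begin
  length (filter P? (List.map (f x) ys ++ cartesianProductWith f xs ys))
    ≡⟨ cong length (filter-++ P? (List.map (f x) ys) _) ⟩
  length (filter P? (List.map (f x) ys) ++ filter P? (cartesianProductWith f xs ys))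
    ≡⟨ length-++ (filter P? (List.map (f x) ys)) ⟩
  length (filter P? (List.map (f x) ys)) + length (filter P? (cartesianProductWith f xs ys))
    ≡⟨ cong₂ _+_ (length-filter-map P? (f x) ys) (length-filter-cartesianProductWith P? f xs ys) ⟩
  length (filter (P? ∘ f x) ys) + sum (List.map (λ x → length (filter (P? ∘ f x) ys)) xs) ∎

length-cartesianProductWith : (f : A → B → C) (xs : List A) (ys : List B) →
                              length (cartesianProductWith f xs ys) ≡ length xs * length ys
length-cartesianProductWith f [] ys = refl
length-cartesianProductWith f (x ∷ xs) ys = begin
  length (List.map (f x) ys ++ cartesianProductWith f xs ys)
    ≡⟨ length-++ (List.map (f x) ys) ⟩
  length (List.map (f x) ys) + length (cartesianProductWith f xs ys)
    ≡⟨ cong₂ _+_ (length-map (f x) ys) (length-cartesianProductWith f xs ys) ⟩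
  length ys + length xs * length ys ∎

unique-⇔⇒length≡ : {xs ys : List A} → Unique xs → Unique ys → (∀ {z} → z ∈ xs ⇔ z ∈ ys) →
                   length xs ≡ length ys
unique-⇔⇒length≡ xs! ys! xs⇔ys = ↭-length (∼bag⇒↭ (unique∧set⇒bag xs! ys! xs⇔ys))

allVecs : ∀ k → List (Vec (Fin n) k)
allVecs zero = [ [] ]
allVecs {n} (suc k) = cartesianProductWith _∷_ (allFin n) (allVecs k)

∈-allVecs : (v : Vec (Fin n) k) → v ∈ allVecs k
∈-allVecs [] = here refl
∈-allVecs (a ∷ v) = ∈-cartesianProductWith⁺ _∷_ (∈-allFin a) (∈-allVecs v)

allVecs-unique : ∀ k → Unique (allVecs {n} k)
allVecs-unique zero = All.[] AllPairs.∷ AllPairs.[]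
allVecs-unique {n} (suc k) = cartesianProductWith⁺ _∷_ ∷-injective (allFin⁺ n) (allVecs-unique k)

countVec≡length-filter : ∀ k (P : Vec (Fin n) k → Set) (P? : Decidable P) →
                         countVec k P P? ≡ length (filter P? (allVecs k))
countVec≡length-filter zero P P? with P? []
... | yes _ = refl
... | no _ = refl
countVec≡length-filter {n} (suc k) P P? = begin
  sum (List.map (λ a → countVec k (P ∘ (a ∷_)) (P? ∘ (a ∷_))) (allFin n))
    ≡⟨ cong sum (map-cong (λ a → countVec≡length-filter k (P ∘ (a ∷_)) (P? ∘ (a ∷_))) (allFin n)) ⟩
  sum (List.map (λ a → length (filter (P? ∘ (a ∷_)) (allVecs k))) (allFin n))
    ≡⟨ length-filter-cartesianProductWith P? _∷_ (allFin n) (allVecs k) ⟨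
  length (filter P? (allVecs (suc k))) ∎

AmongFirstOrLast : ℕ → ℕ → ℕ → ℕ → Set
AmongFirstOrLast m a b t = t < a ⊎ m ≤ t + b

amongFirstOrLast-suc⇔ : ∀ {m a b t} →
                        AmongFirstOrLast (suc m) a b (suc t) ⇔ AmongFirstOrLast m (pred a) b t
amongFirstOrLast-suc⇔ {a = zero} = mk⇔ (Sum.map (λ ()) s≤s⁻¹) (Sum.map (λ ()) s≤s)
amongFirstOrLast-suc⇔ {a = suc a} = mk⇔ (Sum.map s≤s⁻¹ s≤s⁻¹) (Sum.map s≤s s≤s)

length-filter-amongFirstOrLast :
  ∀ m a b {P : A → Set} (P? : Decidable P) (f : Fin m → A) →
  (∀ t → P (f t) ⇔ AmongFirstOrLast m a b (toℕ t)) →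
  length (filter P? (List.tabulate f)) ≡ m ⊓ (a + b)
length-filter-amongFirstOrLast zero a b P? f spec = refl
length-filter-amongFirstOrLast (suc m) (suc a) b P? f spec with P? (f zero)
... | yes _ =
  cong suc (length-filter-amongFirstOrLast m a b P? (f ∘ suc) (λ t → amongFirstOrLast-suc⇔ ⇔-∘ spec (suc t)))
... | no ¬P0 = contradiction (Equivalence.from (spec zero) (inj₁ z<s)) ¬P0
length-filter-amongFirstOrLast (suc m) zero b P? f spec
  with P? (f zero)
     | length-filter-amongFirstOrLast m zero b P? (f ∘ suc) (λ t → amongFirstOrLast-suc⇔ ⇔-∘ spec (suc t))
... | yes P0 | ih with Equivalence.to (spec zero) P0
...   | inj₂ m<b = trans (cong suc (trans ih (m≤n⇒m⊓n≡m (<⇒≤ m<b)))) (sym (m≤n⇒m⊓n≡m m<b))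
length-filter-amongFirstOrLast (suc m) zero b P? f spec | no ¬P0 | ih =
  trans ih (trans (m≥n⇒m⊓n≡n b≤m) (sym (m≥n⇒m⊓n≡n (m≤n⇒m≤1+n b≤m))))
  where
  b≤m : b ≤ m
  b≤m = ≮⇒≥ λ m<b → ¬P0 (Equivalence.from (spec zero) (inj₂ m<b))

lookup-extensionality : {u v : Vec A n} → (∀ q → lookup u q ≡ lookup v q) → u ≡ v
lookup-extensionality {u = u} {v} u≗v = begin
  u                   ≡⟨ tabulate∘lookup u ⟨
  tabulate (lookup u) ≡⟨ tabulate-cong u≗v ⟩
  tabulate (lookup v) ≡⟨ tabulate∘lookup v ⟩
  v                   ∎

≡⊎punchIn : (i q : Fin (suc n)) → q ≡ i ⊎ ∃ λ q′ → q ≡ punchIn i q′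
≡⊎punchIn i q with i ≟ q
... | yes i≡q = inj₁ (sym i≡q)
... | no i≢q = inj₂ (punchOut i≢q , sym (punchIn-punchOut i≢q))

punchIn-mono-< : ∀ (i : Fin (suc n)) j l → j Fin.< l → punchIn i j Fin.< punchIn i l
punchIn-mono-< i j l j<l = ≰⇒> λ pl≤pj → <⇒≱ j<l (punchIn-cancel-≤ i l j pl≤pj)

punchIn-cancel-< : ∀ (i : Fin (suc n)) j l → punchIn i j Fin.< punchIn i l → j Fin.< l
punchIn-cancel-< i j l pj<pl = ≰⇒> λ l≤j → <⇒≱ pj<pl (punchIn-mono-≤ i l j l≤j)

missing⇒map-punchIn : (i : Fin (suc n)) (ι : Vec (Fin (suc n)) k) → (∀ j → i ≢ lookup ι j) →
                      ∃ λ ι′ → ι ≡ map (punchIn i) ι′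
missing⇒map-punchIn i ι i∉ι = ι′ , lookup-extensionality λ j → sym (begin
  lookup (map (punchIn i) ι′) j ≡⟨ lookup-map j (punchIn i) ι′ ⟩
  punchIn i (lookup ι′ j)       ≡⟨ cong (punchIn i) (lookup∘tabulate (λ j → punchOut (i∉ι j)) j) ⟩
  punchIn i (punchOut (i∉ι j))  ≡⟨ punchIn-punchOut (i∉ι j) ⟩
  lookup ι j                    ∎)
  where
  ι′ = tabulate λ j → punchOut (i∉ι j)

insertMax : Fin (suc n) → Vec (Fin n) n → Vec (Fin (suc n)) (suc n)
insertMax {n} i w = insertAt (map inject₁ w) i (fromℕ n)

module _ (i : Fin (suc n)) (w : Vec (Fin n) n) where

  lookup-insertMax-at : lookup (insertMax i w) i ≡ fromℕ n
  lookup-insertMax-at = insertAt-lookup (map inject₁ w) i (fromℕ n)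

  lookup-insertMax-punchIn : ∀ q → lookup (insertMax i w) (punchIn i q) ≡ inject₁ (lookup w q)
  lookup-insertMax-punchIn q = trans (insertAt-punchIn (map inject₁ w) i (fromℕ n) q) (lookup-map q inject₁ w)

  insertMax-max⇒at : ∀ q → lookup (insertMax i w) q ≡ fromℕ n → q ≡ i
  insertMax-max⇒at q πq≡n with ≡⊎punchIn i q
  ... | inj₁ q≡i = q≡i
  ... | inj₂ (q′ , refl) = contradiction (trans (sym πq≡n) (lookup-insertMax-punchIn q′)) fromℕ≢inject₁

  insertMax-below-max : ∀ q → q ≢ i → toℕ (lookup (insertMax i w) q) < n
  insertMax-below-max q q≢i with ≡⊎punchIn i q
  ... | inj₁ q≡i = contradiction q≡i q≢i
  ... | inj₂ (q′ , refl) =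
    subst (λ v → toℕ v < n) (sym (lookup-insertMax-punchIn q′)) (inject₁ℕ< (lookup w q′))

  insertMax-isPerm : IsPerm w → IsPerm (insertMax i w)
  insertMax-isPerm w-perm a b πa≡πb with ≡⊎punchIn i a | ≡⊎punchIn i b
  ... | inj₁ refl | _ = sym (insertMax-max⇒at b (trans (sym πa≡πb) lookup-insertMax-at))
  ... | inj₂ _ | inj₁ refl = insertMax-max⇒at a (trans πa≡πb lookup-insertMax-at)
  ... | inj₂ (a′ , refl) | inj₂ (b′ , refl) = cong (punchIn i) (w-perm a′ b′ (inject₁-injective (begin
    inject₁ (lookup w a′)                 ≡⟨ lookup-insertMax-punchIn a′ ⟨
    lookup (insertMax i w) (punchIn i a′) ≡⟨ πa≡πb ⟩
    lookup (insertMax i w) (punchIn i b′) ≡⟨ lookup-insertMax-punchIn b′ ⟩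
    inject₁ (lookup w b′)                 ∎)))

  isPerm-insertMax⁻ : IsPerm (insertMax i w) → IsPerm w
  isPerm-insertMax⁻ π-perm a b wa≡wb = punchIn-injective i a b (π-perm (punchIn i a) (punchIn i b) (begin
    lookup (insertMax i w) (punchIn i a) ≡⟨ lookup-insertMax-punchIn a ⟩
    inject₁ (lookup w a)                 ≡⟨ cong inject₁ wa≡wb ⟩
    inject₁ (lookup w b)                 ≡⟨ lookup-insertMax-punchIn b ⟨
    lookup (insertMax i w) (punchIn i b) ∎))

insertMax-injective : ∀ {i j : Fin (suc n)} {w v} → insertMax i w ≡ insertMax j v → i ≡ j × w ≡ v
insertMax-injective {i = i} {j} {w} {v} eq
  with insertMax-max⇒at j v i (trans (cong (λ π → lookup π i) (sym eq)) (lookup-insertMax-at i w))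
... | refl = refl , lookup-extensionality λ q → inject₁-injective (begin
  inject₁ (lookup w q)                 ≡⟨ lookup-insertMax-punchIn i w q ⟨
  lookup (insertMax i w) (punchIn i q) ≡⟨ cong (λ π → lookup π (punchIn i q)) eq ⟩
  lookup (insertMax i v) (punchIn i q) ≡⟨ lookup-insertMax-punchIn i v q ⟩
  inject₁ (lookup v q)                 ∎)

uncurry-insertMax-injective : ∀ {a b : Fin (suc n) × Vec (Fin n) n} →
                              uncurry insertMax a ≡ uncurry insertMax b → a ≡ b
uncurry-insertMax-injective {a = i , w} {j , v} eq with insertMax-injective eq
... | refl , refl = refl

isPerm⇒hasMax : (π : Vec (Fin (suc n)) (suc n)) → IsPerm π → ∃ λ i → lookup π i ≡ fromℕ n
isPerm⇒hasMax {n} π π-perm with injective⇒existsPivot {f = lookup π} (π-perm _ _) (fromℕ n)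
... | i , _ , n≤πi = i , ≤-antisym (≤fromℕ (lookup π i)) n≤πi

isPerm⇒insertMax : (π : Vec (Fin (suc n)) (suc n)) → IsPerm π → ∃₂ λ i w → π ≡ insertMax i w
isPerm⇒insertMax {n} π π-perm with isPerm⇒hasMax π π-perm
... | i , πi≡n = i , w , lookup-extensionality π≗
  where
  below : ∀ q → n ≢ toℕ (lookup π (punchIn i q))
  below q n≡ = punchInᵢ≢i i q
    (π-perm _ _ (trans (toℕ-injective (trans (sym n≡) (sym (toℕ-fromℕ n)))) (sym πi≡n)))
  w : Vec (Fin n) n
  w = tabulate λ q → lower₁ (lookup π (punchIn i q)) (below q)
  π≗ : ∀ p → lookup π p ≡ lookup (insertMax i w) p
  π≗ p with ≡⊎punchIn i p
  ... | inj₁ refl = trans πi≡n (sym (lookup-insertMax-at i w))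
  ... | inj₂ (q , refl) = begin
    lookup π (punchIn i q)                              ≡⟨ inject₁-lower₁ _ (below q) ⟨
    inject₁ (lower₁ (lookup π (punchIn i q)) (below q)) ≡⟨ cong inject₁ (lookup∘tabulate _ q) ⟨
    inject₁ (lookup w q)                                ≡⟨ lookup-insertMax-punchIn i w q ⟨
    lookup (insertMax i w) (punchIn i q)                ∎

module _ (p : POP k) (i : Fin (suc n)) (w : Vec (Fin n) n) where

  occurrence-insertMax⇔ : (ι : Vec (Fin n) k) →
                          Occurrence p w ι ⇔ Occurrence p (insertMax i w) (map (punchIn i) ι)
  occurrence-insertMax⇔ ι = mk⇔
    (λ (increasing , ordered) →
      (λ j l j<l →
        subst₂ Fin._<_ (sym (position j)) (sym (position l)) (punchIn-mono-< i _ _ (increasing j l j<l))) ,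
      (λ j l j<ₚl → subst₂ _<_ (sym (value j)) (sym (value l)) (ordered j l j<ₚl)))
    (λ (increasing , ordered) →
      (λ j l j<l → punchIn-cancel-< i _ _ (subst₂ Fin._<_ (position j) (position l) (increasing j l j<l))) ,
      (λ j l j<ₚl → subst₂ _<_ (value j) (value l) (ordered j l j<ₚl)))
    where
    position : ∀ j → lookup (map (punchIn i) ι) j ≡ punchIn i (lookup ι j)
    position j = lookup-map j (punchIn i) ι
    value : ∀ j → toℕ (lookup (insertMax i w) (lookup (map (punchIn i) ι) j)) ≡
                  toℕ (lookup w (lookup ι j))
    value j = begin
      toℕ (lookup (insertMax i w) (lookup (map (punchIn i) ι) j))
        ≡⟨ cong (toℕ ∘ lookup (insertMax i w)) (position j) ⟩
      toℕ (lookup (insertMax i w) (punchIn i (lookup ι j)))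
        ≡⟨ cong toℕ (lookup-insertMax-punchIn i w (lookup ι j)) ⟩
      toℕ (inject₁ (lookup w (lookup ι j)))
        ≡⟨ toℕ-inject₁ (lookup w (lookup ι j)) ⟩
      toℕ (lookup w (lookup ι j)) ∎

  insertMax-avoids⁻ : Avoids p (insertMax i w) → Avoids p w
  insertMax-avoids⁻ π-avoids (ι , occ) =
    π-avoids (map (punchIn i) ι , Equivalence.to (occurrence-insertMax⇔ ι) occ)

strictlyIncreasing-tail : {a : Fin m} {ι : Vec (Fin m) k} → StrictlyIncreasing (a ∷ ι) → StrictlyIncreasing ι
strictlyIncreasing-tail increasing j l j<l = increasing (suc j) (suc l) (s≤s j<l)

head+index≤lookup : ∀ {K} (ι : Vec (Fin m) (suc K)) → StrictlyIncreasing ι →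
                    ∀ j → toℕ (lookup ι zero) + toℕ j ≤ toℕ (lookup ι j)
head+index≤lookup ι increasing zero = ≤-reflexive (+-identityʳ _)
head+index≤lookup (a ∷ b ∷ ι) increasing (suc j) =
  ≤-trans (≤-reflexive (+-suc (toℕ a) (toℕ j)))
    (≤-trans (+-monoˡ-≤ (toℕ j) (increasing zero (suc zero) (s≤s z≤n)))
      (head+index≤lookup (b ∷ ι) (strictlyIncreasing-tail increasing) j))

lookup+rest≤last : ∀ {K} (ι : Vec (Fin m) (suc K)) → StrictlyIncreasing ι →
                   ∀ j → toℕ (lookup ι j) + (K ∸ toℕ j) ≤ toℕ (lookup ι (fromℕ K))
lookup+rest≤last {K = K} ι increasing zero =
  subst (λ r → toℕ (lookup ι zero) + r ≤ toℕ (lookup ι (fromℕ K))) (toℕ-fromℕ K)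
    (head+index≤lookup ι increasing (fromℕ K))
lookup+rest≤last {K = suc K} (a ∷ ι) increasing (suc j) =
  lookup+rest≤last ι (strictlyIncreasing-tail increasing) j

strictlyIncreasing-injective : (ι : Vec (Fin m) k) → StrictlyIncreasing ι →
                               ∀ j l → lookup ι j ≡ lookup ι l → j ≡ l
strictlyIncreasing-injective ι increasing j l ιj≡ιl with <-cmp j l
... | tri< j<l _ _ = contradiction (cong toℕ ιj≡ιl) (<⇒≢ (increasing j l j<l))
... | tri≈ _ j≡l _ = j≡l
... | tri> _ _ l<j = contradiction (cong toℕ (sym ιj≡ιl)) (<⇒≢ (increasing l j l<j))

avoider? : (p : POP k) → Decidable (λ (π : Vec (Fin n) n) → IsPerm π × Avoids p π)
avoider? p π = IsPerm? π ×-dec Avoids? p π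

avoiders : POP k → ∀ n → List (Vec (Fin n) n)
avoiders p n = filter (avoider? p) (allVecs n)

numAvoiders≡length-avoiders : (p : POP k) → ∀ n → numAvoiders p n ≡ length (avoiders p n)
numAvoiders≡length-avoiders p n = countVec≡length-filter n _ (avoider? p)

numAvoiders-zero : (p : POP (suc k)) → numAvoiders p 0 ≡ 1
numAvoiders-zero p = cong (λ b → if b then 1 else 0) (dec-true (avoider? p []) ((λ ()) , empty-avoids))
  where
  empty-avoids : Avoids p []
  empty-avoids ((() ∷ _) , _)

module _ {K : ℕ} (x : Fin (suc K)) where

  α β : ℕ
  α = toℕ x
  β = K ∸ toℕ x

  position-x-bounds : (ι : Vec (Fin (suc n)) (suc K)) → StrictlyIncreasing ι →
                      α ≤ toℕ (lookup ι x) × toℕ (lookup ι x) + β ≤ n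
  position-x-bounds ι increasing =
    ≤-trans (m≤n+m α _) (head+index≤lookup ι increasing x) ,
    ≤-trans (lookup+rest≤last ι increasing x) (toℕ≤pred[n] (lookup ι (fromℕ K)))

  occurrence-max⇒label-x : (π : Vec (Fin (suc n)) (suc n)) (ι : Vec (Fin (suc n)) (suc K)) →
                           Occurrence (maxPOP x) π ι → ∀ j → lookup π (lookup ι j) ≡ fromℕ n → j ≡ x
  occurrence-max⇒label-x π ι (_ , ordered) j πιj≡n with j ≟ x
  ... | yes j≡x = j≡x
  ... | no j≢x = contradiction (subst (lookup π (lookup ι x) Fin.≤_) (sym πιj≡n) (≤fromℕ _))
                               (<⇒≱ (ordered j x (refl , j≢x)))

  strictlyIncreasing-through : (t : Fin (suc n)) → α ≤ toℕ t → toℕ t + β ≤ n →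
                               ∃ λ ι → StrictlyIncreasing ι × lookup ι x ≡ t
  strictlyIncreasing-through {n} t α≤t t+β≤n = ι , increasing , toℕ-injective (trans (toℕ-lookup x) pos-x)
    where
    -- ι = (0, 1, …, α - 1, t, t + 1, …, t + β)
    pos : Fin (suc K) → ℕ
    pos j with toℕ j <? α
    ... | yes _ = toℕ j
    ... | no _ = toℕ t + (toℕ j ∸ α)

    pos<1+n : ∀ j → pos j < suc n
    pos<1+n j with toℕ j <? α
    ... | yes j<α = s≤s (≤-trans (<⇒≤ j<α) (≤-trans α≤t (≤-trans (m≤m+n (toℕ t) β) t+β≤n)))
    ... | no _ = s≤s (≤-trans (+-monoʳ-≤ (toℕ t) (∸-monoˡ-≤ α (toℕ≤pred[n] j))) t+β≤n)

    pos-mono : ∀ j l → j Fin.< l → pos j < pos l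
    pos-mono j l j<l with toℕ j <? α | toℕ l <? α
    ... | yes _   | yes _   = j<l
    ... | yes j<α | no _    = <-≤-trans j<α (≤-trans α≤t (m≤m+n (toℕ t) _))
    ... | no j≮α  | yes l<α = contradiction (≤-<-trans (≮⇒≥ j≮α) (<-trans j<l l<α)) (n≮n α)
    ... | no j≮α  | no _    = +-monoʳ-< (toℕ t) (∸-monoˡ-< j<l (≮⇒≥ j≮α))

    pos-x : pos x ≡ toℕ t
    pos-x with toℕ x <? α
    ... | yes x<α = contradiction x<α (n≮n α)
    ... | no _ = trans (cong (toℕ t +_) (n∸n≡0 α)) (+-identityʳ (toℕ t))

    ι : Vec (Fin (suc n)) (suc K)
    ι = tabulate λ j → fromℕ< (pos<1+n j)

    toℕ-lookup : ∀ j → toℕ (lookup ι j) ≡ pos j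
    toℕ-lookup j =
      trans (cong toℕ (lookup∘tabulate (λ j → fromℕ< (pos<1+n j)) j)) (toℕ-fromℕ< (pos<1+n j))

    increasing : StrictlyIncreasing ι
    increasing j l j<l = subst₂ _<_ (sym (toℕ-lookup j)) (sym (toℕ-lookup l)) (pos-mono j l j<l)

  module _ (i : Fin (suc n)) (w : Vec (Fin n) n) where

    insertMax-avoids : Avoids (maxPOP x) w → AmongFirstOrLast (suc n) α β (toℕ i) →
                       Avoids (maxPOP x) (insertMax i w)
    insertMax-avoids w-avoids allowed (ι , occ) with any? (λ j → i ≟ lookup ι j)
    ... | yes (j , i≡ιj)
      with occurrence-max⇒label-x (insertMax i w) ι occ j
             (trans (cong (lookup (insertMax i w)) (sym i≡ιj)) (lookup-insertMax-at i w))
    ...   | refl with i≡ιj | position-x-bounds ι (proj₁ occ) | allowed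
    ...     | refl | α≤i , _   | inj₁ i<α   = <⇒≱ i<α α≤i
    ...     | refl | _ , i+β≤n | inj₂ n<i+β = <⇒≱ n<i+β i+β≤n
    insertMax-avoids w-avoids allowed (ι , occ) | no i∉ι
      with missing⇒map-punchIn i ι (λ j i≡ιj → i∉ι (j , i≡ιj))
    ... | ι′ , refl = w-avoids (ι′ , Equivalence.from (occurrence-insertMax⇔ (maxPOP x) i w ι′) occ)

    insertMax-avoids⇒allowed : Avoids (maxPOP x) (insertMax i w) → AmongFirstOrLast (suc n) α β (toℕ i)
    insertMax-avoids⇒allowed π-avoids with toℕ i <? α | n <? toℕ i + β
    ... | yes i<α | _         = inj₁ i<α
    ... | no _    | yes n<i+β = inj₂ n<i+β
    ... | no i≮α  | no n≮i+β with strictlyIncreasing-through i (≮⇒≥ i≮α) (≮⇒≥ n≮i+β)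
    ...   | ι , increasing , ιx≡i = contradiction (ι , increasing , ordered) π-avoids
      where
      π = insertMax i w
      ordered : ∀ j l → _<P_ (maxPOP x) j l → lookup π (lookup ι j) Fin.< lookup π (lookup ι l)
      ordered j _ (refl , j≢x) =
        subst (toℕ (lookup π (lookup ι j)) <_) n≡πιx (insertMax-below-max i w (lookup ι j) ιj≢i)
        where
        n≡πιx : n ≡ toℕ (lookup π (lookup ι x))
        n≡πιx = begin
          n                           ≡⟨ toℕ-fromℕ n ⟨
          toℕ (fromℕ n)               ≡⟨ cong toℕ (trans (cong (lookup π) ιx≡i) (lookup-insertMax-at i w)) ⟨
          toℕ (lookup π (lookup ι x)) ∎
        ιj≢i : lookup ι j ≢ i
        ιj≢i ιj≡i = j≢x (strictlyIncreasing-injective ι increasing j x (trans ιj≡i (sym ιx≡i)))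

  allowed? : ∀ n → Decidable (λ (i : Fin (suc n)) → AmongFirstOrLast (suc n) α β (toℕ i))
  allowed? n i = (toℕ i <? α) ⊎-dec (n <? toℕ i + β)

  length-allowed : ∀ n → length (filter (allowed? n) (allFin (suc n))) ≡ suc n ⊓ K
  length-allowed n =
    trans (length-filter-amongFirstOrLast (suc n) α β (allowed? n) (λ i → i) (λ _ → ⇔.refl))
          (cong (suc n ⊓_) (m+[n∸m]≡n (toℕ≤pred[n] x)))

  insertions : ∀ n → List (Vec (Fin (suc n)) (suc n))
  insertions n =
    List.map (uncurry insertMax) (cartesianProduct (filter (allowed? n) (allFin (suc n))) (avoiders (maxPOP x) n))

  avoiders-suc⇔insertions : ∀ {n π} → π ∈ avoiders (maxPOP x) (suc n) ⇔ π ∈ insertions n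
  avoiders-suc⇔insertions {n} {π} = mk⇔ to from
    where
    to : π ∈ avoiders (maxPOP x) (suc n) → π ∈ insertions n
    to π∈ with ∈-filter⁻ (avoider? (maxPOP x)) {xs = allVecs (suc n)} π∈
    ... | _ , π-perm , π-avoids with isPerm⇒insertMax π π-perm
    ...   | i , w , refl = ∈-map⁺ (uncurry insertMax) (∈-cartesianProduct⁺
              (∈-filter⁺ (allowed? n) (∈-allFin i) (insertMax-avoids⇒allowed i w π-avoids))
              (∈-filter⁺ (avoider? (maxPOP x)) (∈-allVecs w)
                (isPerm-insertMax⁻ i w π-perm , insertMax-avoids⁻ (maxPOP x) i w π-avoids)))
    from : π ∈ insertions n → π ∈ avoiders (maxPOP x) (suc n)
    from π∈ with ∈-map⁻ (uncurry insertMax) π∈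
    ... | (i , w) , iw∈ , refl
      with ∈-cartesianProduct⁻ (filter (allowed? n) (allFin (suc n))) (avoiders (maxPOP x) n) iw∈
    ...   | i∈ , w∈ with ∈-filter⁻ (allowed? n) {xs = allFin (suc n)} i∈
                       | ∈-filter⁻ (avoider? (maxPOP x)) {xs = allVecs n} w∈
    ...     | _ , allowed | _ , w-perm , w-avoids =
      ∈-filter⁺ (avoider? (maxPOP x)) (∈-allVecs _)
        (insertMax-isPerm i w w-perm , insertMax-avoids i w w-avoids allowed)

  insertions-unique : ∀ n → Unique (insertions n)
  insertions-unique n = map⁺ uncurry-insertMax-injective
    (cartesianProduct⁺ {xs = filter (allowed? n) (allFin (suc n))} {ys = avoiders (maxPOP x) n}
      (filter⁺ (allowed? n) (allFin⁺ (suc n))) (filter⁺ (avoider? (maxPOP x)) (allVecs-unique n)))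

  numAvoiders-suc : ∀ n → numAvoiders (maxPOP x) (suc n) ≡ (suc n ⊓ K) * numAvoiders (maxPOP x) n
  numAvoiders-suc n = begin
    numAvoiders (maxPOP x) (suc n)
      ≡⟨ numAvoiders≡length-avoiders (maxPOP x) (suc n) ⟩
    length (avoiders (maxPOP x) (suc n))
      ≡⟨ unique-⇔⇒length≡ (filter⁺ (avoider? (maxPOP x)) (allVecs-unique (suc n))) (insertions-unique n)
                           avoiders-suc⇔insertions ⟩
    length (insertions n)
      ≡⟨ length-map (uncurry insertMax) (cartesianProduct allowed avoiding) ⟩
    length (cartesianProduct allowed avoiding)
      ≡⟨ length-cartesianProductWith _,_ allowed avoiding ⟩
    length allowed * length avoiding
      ≡⟨ cong₂ _*_ (length-allowed n) (sym (numAvoiders≡length-avoiders (maxPOP x) n)) ⟩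
    (suc n ⊓ K) * numAvoiders (maxPOP x) n ∎
    where
    allowed = filter (allowed? n) (allFin (suc n))
    avoiding = avoiders (maxPOP x) n

  numAvoiders-≤K : ∀ n → n ≤ K → numAvoiders (maxPOP x) n ≡ n !
  numAvoiders-≤K zero _ = numAvoiders-zero (maxPOP x)
  numAvoiders-≤K (suc n) n<K = begin
    numAvoiders (maxPOP x) (suc n)
      ≡⟨ numAvoiders-suc n ⟩
    (suc n ⊓ K) * numAvoiders (maxPOP x) n
      ≡⟨ cong₂ _*_ (m≤n⇒m⊓n≡m n<K) (numAvoiders-≤K n (<⇒≤ n<K)) ⟩
    suc n * n ! ∎

  numAvoiders-K+ : ∀ t → numAvoiders (maxPOP x) (K + t) ≡ K ! * K ^ t
  numAvoiders-K+ zero = begin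
    numAvoiders (maxPOP x) (K + 0) ≡⟨ cong (numAvoiders (maxPOP x)) (+-identityʳ K) ⟩
    numAvoiders (maxPOP x) K       ≡⟨ numAvoiders-≤K K ≤-refl ⟩
    K !                            ≡⟨ *-identityʳ (K !) ⟨
    K ! * 1                        ∎
  numAvoiders-K+ (suc t) = begin
    numAvoiders (maxPOP x) (K + suc t)
      ≡⟨ cong (numAvoiders (maxPOP x)) (+-suc K t) ⟩
    numAvoiders (maxPOP x) (suc (K + t))
      ≡⟨ numAvoiders-suc (K + t) ⟩
    (suc (K + t) ⊓ K) * numAvoiders (maxPOP x) (K + t)
      ≡⟨ cong₂ _*_ (m≥n⇒m⊓n≡n (m≤n⇒m≤1+n (m≤m+n K t))) (numAvoiders-K+ t) ⟩
    K * (K ! * K ^ t)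
      ≡⟨ x∙yz≈y∙xz K (K !) (K ^ t) ⟩
    K ! * (K * K ^ t) ∎

  numAvoiders->K : ∀ n → K < n → numAvoiders (maxPOP x) n ≡ K ! * K ^ suc (n ∸ suc K)
  numAvoiders->K n K<n = trans (cong (numAvoiders (maxPOP x)) n≡K+[1+n∸1+K]) (numAvoiders-K+ (suc (n ∸ suc K)))
    where
    n≡K+[1+n∸1+K] : n ≡ K + suc (n ∸ suc K)
    n≡K+[1+n∸1+K] = sym (trans (+-suc K (n ∸ suc K)) (m+[n∸m]≡n K<n))

  numAvoiders≡rhsSeries : ∀ n → numAvoiders (maxPOP x) n ≡ rhsSeries (suc K) n
  numAvoiders≡rhsSeries n with n <? suc K
  ... | yes n<k rewrite dec-false (suc K ≤? n) (<⇒≱ n<k) | dec-true (n <? suc K) n<k =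
    trans (numAvoiders-≤K n (s≤s⁻¹ n<k)) (cong (_+ n !) (sym (*-zeroʳ (K * K !))))
  ... | no n≮k rewrite dec-true (suc K ≤? n) (≮⇒≥ n≮k) | dec-false (n <? suc K) n≮k = begin
    numAvoiders (maxPOP x) n      ≡⟨ numAvoiders->K n (≮⇒≥ n≮k) ⟩
    K ! * (K * K ^ (n ∸ suc K))   ≡⟨ x∙yz≈y∙xz (K !) K (K ^ (n ∸ suc K)) ⟩
    K * (K ! * K ^ (n ∸ suc K))   ≡⟨ *-assoc K (K !) (K ^ (n ∸ suc K)) ⟨
    K * K ! * K ^ (n ∸ suc K)     ≡⟨ +-identityʳ _ ⟨
    K * K ! * K ^ (n ∸ suc K) + 0 ∎

theorem2 : (k : ℕ) → 1 ≤ k → (x : Fin k) →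
    ((n : ℕ) →
      (n < k → numAvoiders (maxPOP x) n ≡ n !) ×
      (k ≤ n → numAvoiders (maxPOP x) n ≡ (k ∸ 1) ! * (k ∸ 1) ^ (n ∸ k + 1)))
    × ((n : ℕ) → numAvoiders (maxPOP x) n ≡ rhsSeries k n)
theorem2 (suc K) _ x = (λ n → numAvoiders-≤K x n ∘ s≤s⁻¹ , numAvoiders-≥k n) , numAvoiders≡rhsSeries x
  where
  numAvoiders-≥k : ∀ n → suc K ≤ n → numAvoiders (maxPOP x) n ≡ K ! * K ^ (n ∸ suc K + 1)
  numAvoiders-≥k n K<n = trans (numAvoiders->K x n K<n) (cong (λ e → K ! * K ^ e) (+-comm 1 (n ∸ suc K)))
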